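{- Let $G$ and $H$ be finite simple graphs. If $\Gamma(G)=\Delta(G)+1$, then $\Gamma(G[H])=\Gamma(G)\cdot\Gamma(H)$.
   Context: $\Delta(G)$ denotes the maximum degree of $G$. A greedy $k$-colouring of a graph is a partition of its vertex set into $k$ nonempty stable sets $S_1,\dots,S_k$ such that for every $j<i$, every vertex of $S_i$ has a neighbour in $S_j$. The Grundy number $\Gamma$ is the largest such $k$. The lexicographic product $G[H]$ has vertex set $V(G)\times V(H)$, and $(a,x)(b,y)$ is an edge iff $ab\in E(G)$, or $a=b$ and $xy\in E(H)$. -}

module Defs where

open import Data.Nat using (ℕ; _⊔_; _≤_; _<_; _*_)
open import Data.Fin using (Fin; toℕ; remQuot)
import Data.Fin as F
open import Data.Product using (Σ; ∃; _×_; _,_; proj₁; proj₂)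
open import Data.Sum using (_⊎_; inj₁; inj₂)
import Relation.Nullary.Decidable as Dec
open import Relation.Binary.PropositionalEquality using (refl)
import Relation.Binary.PropositionalEquality as Eq
open import Data.List using (List; length; filter; map; foldr; allFin)
open import Relation.Nullary using (¬_; Dec)
open import Relation.Binary.PropositionalEquality using (_≡_; _≢_)
open import Level using (0ℓ)

record Graph : Set₁ where
  field
    n     : ℕ
    Adj   : Fin n → Fin n → Set
    adj?  : ∀ u v → Dec (Adj u v)
    sym   : ∀ {u v} → Adj u v → Adj v u
    irrefl : ∀ {u} → ¬ Adj u u
open Graph public

degree : (G : Graph) → Fin (n G) → ℕ
degree G v = length (filter (adj? G v) (allFin (n G)))

maxDegree : Graph → ℕ
maxDegree G = foldr _⊔_ 0 (map (degree G) (allFin (n G)))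

-- A greedy k-colouring: c v is the index of the stable set containing v
-- (classes S_1..S_k represented by Fin k, 0-indexed).
record GreedyColouring (G : Graph) (k : ℕ) : Set where
  field
    colour   : Fin (n G) → Fin k
    nonempty : ∀ (i : Fin k) → ∃ λ v → colour v ≡ i
    stable   : ∀ {u v} → Adj G u v → colour u ≢ colour v
    greedy   : ∀ (v : Fin (n G)) (j : Fin k) → toℕ j < toℕ (colour v) →
               ∃ λ u → Adj G v u × colour u ≡ j

IsGrundyNumber : Graph → ℕ → Set
IsGrundyNumber G k = GreedyColouring G k × (∀ m → GreedyColouring G m → m ≤ k)

-- Lexicographic product G[H] on Fin (n G * n H); vertex i ↔ (a , x) = remQuot i.
lexAdj : (G H : Graph) → (Fin (n G) × Fin (n H)) → (Fin (n G) × Fin (n H)) → Set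
lexAdj G H (a , x) (b , y) = Adj G a b ⊎ (a ≡ b × Adj H x y)

lexAdj? : (G H : Graph) → ∀ p q → Dec (lexAdj G H p q)
lexAdj? G H (a , x) (b , y) = adj? G a b Dec.⊎-dec (a F.≟ b Dec.×-dec adj? H x y)

lexSym : (G H : Graph) → ∀ {p q} → lexAdj G H p q → lexAdj G H q p
lexSym G H (inj₁ e) = inj₁ (sym G e)
lexSym G H (inj₂ (refl , e)) = inj₂ (refl , sym H e)

lexIrrefl : (G H : Graph) → ∀ {p} → ¬ lexAdj G H p p
lexIrrefl G H (inj₁ e) = irrefl G e
lexIrrefl G H (inj₂ (_ , e)) = irrefl H e

lex : Graph → Graph → Graph
lex G H = record
  { n = n G * n H
  ; Adj = λ i j → lexAdj G H (remQuot (n H) i) (remQuot (n H) j)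
  ; adj? = λ i j → lexAdj? G H (remQuot (n H) i) (remQuot (n H) j)
  ; sym = lexSym G H
  ; irrefl = lexIrrefl G H
  }

-- Γ(G)Γ(H) ≤ Γ(G[H]) holds for all G and H: colour (a , x) by the pair of
-- the colours of a and x, ordered lexicographically.
--
-- Conversely, let v = (a , x) carry the top colour of a greedy colouring
-- of G[H]. Every colour occurs at v or at a neighbour of v, hence in one of
-- the at most Δ(G) + 1 fibres {b} × H with b in the closed neighbourhood of a.
-- Inside a fibre the colouring is greedy with respect to the colours that
-- occur in that fibre, so after renumbering those colours increasingly it
-- becomes a greedy colouring of H: each fibre carries at most Γ(H) colours.
-- Thus Γ(G[H]) ≤ (Δ(G) + 1) Γ(H), which is Γ(G)Γ(H) when Γ(G) = Δ(G) + 1.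
module Submission where

open import Defs hiding (sym)
open import Data.Nat using (ℕ; _+_; _*_)
open import Relation.Binary.PropositionalEquality using (_≡_)

open import Level using (Level)
open import Data.Nat as ℕ using (zero; suc; z≤n; s≤s; z<s; s<s; s<s⁻¹; _⊔_)
import Data.Nat.Properties as ℕ
open import Data.Fin as F using (Fin; zero; suc; combine; remQuot; fromℕ; inject≤; _<_)
open import Data.Fin.Properties
  using (toℕ-combine; combine-monoˡ-<; combine-injectiveˡ; combine-injectiveʳ; combine-injective;
         combine-surjective; remQuot-combine; inject≤-injective;
         injective⇒≤; ≤fromℕ; ≤∧≢⇒<; <⇒≢; <-cmp; any?; suc-injective)
open import Data.Product using (∃; ∃₂; _×_; _,_; proj₁; proj₂; uncurry)
open import Data.Sum using (_⊎_; inj₁; inj₂)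
open import Data.Empty using (⊥-elim)
open import Data.List using (List; _∷_; filter; foldr; allFin; lookup)
open import Data.List.Membership.Propositional using (_∈_)
open import Data.List.Membership.Propositional.Properties using (∈-filter⁺; ∈-map⁺; ∈-allFin)
open import Data.List.Relation.Unary.Any as Any using (here; there)
open import Data.List.Relation.Unary.Any.Properties using (lookup-index)
open import Function using (_∘_)
open import Relation.Binary using (tri<; tri≈; tri>)
open import Relation.Binary.PropositionalEquality
  using (refl; sym; trans; cong; subst; subst₂; _≢_)
open import Relation.Nullary using (¬_; yes; no; contradiction)
open import Relation.Unary using (Pred; Decidable)

private
  variable
    ℓ : Level
    m : ℕ

record Enumeration (m : ℕ) (P : Pred (Fin m) ℓ) : Set ℓ where
  field
    size            : ℕ
    elem            : Fin size → Fin m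
    elem-strictMono : ∀ {i j} → i < j → elem i < elem j
    elem-∈          : ∀ i → P (elem i)
    index           : ∀ j → P j → Fin size
    elem-index      : ∀ j (p : P j) → elem (index j p) ≡ j

  elem-injective : ∀ {i j} → elem i ≡ elem j → i ≡ j
  elem-injective {i} {j} eq with <-cmp i j
  ... | tri< i<j _ _ = contradiction eq (<⇒≢ (elem-strictMono i<j))
  ... | tri≈ _ i≡j _ = i≡j
  ... | tri> _ _ j<i = contradiction (sym eq) (<⇒≢ (elem-strictMono j<i))

  index-elem : ∀ {i j} (p : P j) → elem i ≡ j → index j p ≡ i
  index-elem {i} {j} p eq = elem-injective (trans (elem-index j p) (sym eq))

  index-injective : ∀ {j j′} (p : P j) (p′ : P j′) → index j p ≡ index j′ p′ → j ≡ j′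
  index-injective {j} {j′} p p′ eq =
    trans (sym (elem-index j p)) (trans (cong elem eq) (elem-index j′ p′))

open Enumeration

module _ {P : Pred (Fin (suc m)) ℓ} where

  skip : ¬ P zero → Enumeration m (P ∘ suc) → Enumeration (suc m) P
  skip ¬p E .size                    = E .size
  skip ¬p E .elem i                  = suc (E .elem i)
  skip ¬p E .elem-strictMono i<j     = s<s (E .elem-strictMono i<j)
  skip ¬p E .elem-∈                  = E .elem-∈
  skip ¬p E .index zero p            = ⊥-elim (¬p p)
  skip ¬p E .index (suc j) p         = E .index j p
  skip ¬p E .elem-index zero p       = ⊥-elim (¬p p)
  skip ¬p E .elem-index (suc j) p    = cong suc (E .elem-index j p)

  keep : P zero → Enumeration m (P ∘ suc) → Enumeration (suc m) P
  keep p E .size                                 = suc (E .size)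
  keep p E .elem zero                            = zero
  keep p E .elem (suc i)                         = suc (E .elem i)
  keep p E .elem-strictMono {zero}  {suc j} _    = z<s
  keep p E .elem-strictMono {suc i} {suc j} i<j  = s<s (E .elem-strictMono (s<s⁻¹ i<j))
  keep p E .elem-∈ zero                          = p
  keep p E .elem-∈ (suc i)                       = E .elem-∈ i
  keep p E .index zero _                         = zero
  keep p E .index (suc j) q                      = suc (E .index j q)
  keep p E .elem-index zero _                    = refl
  keep p E .elem-index (suc j) q                 = cong suc (E .elem-index j q)

enumerate : ∀ m {P : Pred (Fin m) ℓ} → Decidable P → Enumeration m P
enumerate zero P? .size = 0
enumerate zero P? .elem ()
enumerate zero P? .elem-strictMono {()}
enumerate zero P? .elem-∈ ()
enumerate zero P? .index ()
enumerate zero P? .elem-index ()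
enumerate (suc m) {P} P? with P? zero
... | yes p = keep p (enumerate m {P ∘ suc} (P? ∘ suc))
... | no ¬p = skip ¬p (enumerate m {P ∘ suc} (P? ∘ suc))

module _ (H : Graph) (c : Fin (n H) → Fin m) where

  Occurs : Pred (Fin m) _
  Occurs j = ∃ λ x → c x ≡ j

  occurring : Enumeration m Occurs
  occurring = enumerate m (λ j → any? (λ x → c x F.≟ j))

  compress : (∀ {x y} → Adj H x y → c x ≢ c y) →
             (∀ x j → j < c x → Occurs j → ∃ λ y → Adj H x y × c y ≡ j) →
             GreedyColouring H (occurring .size)
  compress c-stable c-greedy = record
    { colour   = colour′
    ; nonempty = λ i → let (y , cy≡i) = occurring .elem-∈ i in y , index-elem occurring _ (sym cy≡i)
    ; stable   = λ xy eq → c-stable xy (index-injective occurring _ _ eq)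
    ; greedy   = greedy′
    }
    where
    colour′ : Fin (n H) → Fin (occurring .size)
    colour′ x = occurring .index (c x) (x , refl)

    greedy′ : ∀ x j → j < colour′ x → ∃ λ y → Adj H x y × colour′ y ≡ j
    greedy′ x j j<x with c-greedy x (occurring .elem j) j<cx (occurring .elem-∈ j)
      where
      j<cx : occurring .elem j < c x
      j<cx = subst (occurring .elem j <_) (occurring .elem-index (c x) (x , refl))
                   (occurring .elem-strictMono j<x)
    ... | y , xy , cy≡j = y , xy , index-elem occurring _ (sym cy≡j)

record GreedyLexColouring (G H : Graph) (k : ℕ) : Set where
  field
    colour   : Fin (n G) → Fin (n H) → Fin k
    nonempty : ∀ i → ∃₂ λ a x → colour a x ≡ i
    stable   : ∀ {a x b y} → lexAdj G H (a , x) (b , y) → colour a x ≢ colour b y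
    greedy   : ∀ a x j → j < colour a x →
               ∃₂ λ b y → lexAdj G H (a , x) (b , y) × colour b y ≡ j

module _ {G H : Graph} {k : ℕ} where

  lexAdj⇒Adj : ∀ {a x b y} → lexAdj G H (a , x) (b , y) →
               Adj (lex G H) (combine a x) (combine b y)
  lexAdj⇒Adj {a} {x} {b} {y} =
    subst₂ (lexAdj G H) (sym (remQuot-combine a x)) (sym (remQuot-combine b y))

  Adj⇒lexAdj : ∀ {a x b y} → Adj (lex G H) (combine a x) (combine b y) →
               lexAdj G H (a , x) (b , y)
  Adj⇒lexAdj {a} {x} {b} {y} = subst₂ (lexAdj G H) (remQuot-combine a x) (remQuot-combine b y)

  fromPairs : GreedyLexColouring G H k → GreedyColouring (lex G H) k
  fromPairs C = record
    { colour   = colour′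
    ; nonempty = nonempty′
    ; stable   = stable
    ; greedy   = greedy′
    }
    where
    open GreedyLexColouring C

    colour′ : Fin (n G * n H) → Fin k
    colour′ = uncurry colour ∘ remQuot (n H)

    colour′-combine : ∀ a x → colour′ (combine a x) ≡ colour a x
    colour′-combine a x = cong (uncurry colour) (remQuot-combine a x)

    nonempty′ : ∀ i → ∃ λ v → colour′ v ≡ i
    nonempty′ i with nonempty i
    ... | a , x , refl = combine a x , colour′-combine a x

    greedy′ : ∀ v j → j < colour′ v → ∃ λ u → Adj (lex G H) v u × colour′ u ≡ j
    greedy′ v j j<v with greedy _ _ j j<v
    ... | b , y , vu , refl =
      combine b y , subst (lexAdj G H _) (sym (remQuot-combine b y)) vu , colour′-combine b y

  toPairs : GreedyColouring (lex G H) k → GreedyLexColouring G H k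
  toPairs C = record
    { colour   = λ a x → colour (combine a x)
    ; nonempty = nonempty′
    ; stable   = stable ∘ lexAdj⇒Adj
    ; greedy   = greedy′
    }
    where
    open GreedyColouring C

    nonempty′ : ∀ i → ∃₂ λ a x → colour (combine a x) ≡ i
    nonempty′ i with nonempty i
    ... | v , refl with combine-surjective {n G} {n H} v
    ...   | a , x , refl = a , x , refl

    greedy′ : ∀ a x j → j < colour (combine a x) →
              ∃₂ λ b y → lexAdj G H (a , x) (b , y) × colour (combine b y) ≡ j
    greedy′ a x j j<ax with greedy (combine a x) j j<ax
    ... | u , axu , refl with combine-surjective {n G} {n H} u
    ...   | b , y , refl = b , y , Adj⇒lexAdj axu , refl

-- Lower bound: Γ(G) Γ(H) ≤ Γ(G[H])

combine<combine⇒lex< : ∀ {n} (i j : Fin m) (k l : Fin n) → combine i k < combine j l →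
                      i < j ⊎ (i ≡ j × k < l)
combine<combine⇒lex< i j k l ik<jl with <-cmp i j
... | tri< i<j _ _ = inj₁ i<j
... | tri≈ _ refl _ =
  inj₂ (refl , ℕ.+-cancelˡ-< _ _ _ (subst₂ ℕ._<_ (toℕ-combine i k) (toℕ-combine i l) ik<jl))
... | tri> _ _ j<i = contradiction ik<jl (ℕ.<-asym (combine-monoˡ-< l k j<i))

lexProductColouring : ∀ {G H k l} → GreedyColouring G k → GreedyColouring H l →
                      GreedyLexColouring G H (k * l)
lexProductColouring {G} {H} {k} {l} CG CH = record
  { colour   = colour
  ; nonempty = nonempty
  ; stable   = stable
  ; greedy   = greedy
  }
  where
  module CG = GreedyColouring CG
  module CH = GreedyColouring CH

  colour : Fin (n G) → Fin (n H) → Fin (k * l)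
  colour a x = combine (CG.colour a) (CH.colour x)

  nonempty : ∀ i → ∃₂ λ a x → colour a x ≡ i
  nonempty i with combine-surjective {k} {l} i
  ... | p , q , refl with CG.nonempty p | CH.nonempty q
  ...   | a , refl | x , refl = a , x , refl

  stable : ∀ {a x b y} → lexAdj G H (a , x) (b , y) → colour a x ≢ colour b y
  stable (inj₁ ab)          eq = CG.stable ab (combine-injectiveˡ _ (CH.colour _) _ (CH.colour _) eq)
  stable (inj₂ (refl , xy)) eq = CH.stable xy (combine-injectiveʳ (CG.colour _) _ (CG.colour _) _ eq)

  greedy : ∀ a x j → j < colour a x → ∃₂ λ b y → lexAdj G H (a , x) (b , y) × colour b y ≡ j
  greedy a x j j<ax with combine-surjective {k} {l} j
  ... | p , q , refl with combine<combine⇒lex< p _ q _ j<ax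
  ...   | inj₁ p<a with CG.greedy a p p<a | CH.nonempty q
  ...     | b , ab , refl | y , refl = b , y , inj₁ ab , refl
  greedy a x _ _ | p , q , refl | inj₂ (refl , q<x) with CH.greedy x q q<x
  ...     | y , xy , refl = a , y , inj₂ (refl , xy) , refl

≤-foldr-⊔ : ∀ {x} {xs : List ℕ} → x ∈ xs → x ℕ.≤ foldr _⊔_ 0 xs
≤-foldr-⊔ {xs = y ∷ ys} (here refl) = ℕ.m≤m⊔n y _
≤-foldr-⊔ {xs = y ∷ ys} (there x∈ys) = ℕ.≤-trans (≤-foldr-⊔ x∈ys) (ℕ.m≤n⊔m y _)

degree≤maxDegree : ∀ G (a : Fin (n G)) → degree G a ℕ.≤ maxDegree G
degree≤maxDegree G a = ≤-foldr-⊔ (∈-map⁺ (degree G) (∈-allFin a))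

module _ (G : Graph) where

  ClosedNeighbour : Fin (n G) → Fin (n G) → Set
  ClosedNeighbour a b = b ≡ a ⊎ Adj G a b

  neighbours : Fin (n G) → List (Fin (n G))
  neighbours a = filter (adj? G a) (allFin (n G))

  neighbour∈ : ∀ {a b} → Adj G a b → b ∈ neighbours a
  neighbour∈ ab = ∈-filter⁺ (adj? G _) (∈-allFin _) ab

  closedIndex : ∀ {a b} → ClosedNeighbour a b → Fin (suc (degree G a))
  closedIndex (inj₁ _)  = zero
  closedIndex (inj₂ ab) = suc (Any.index (neighbour∈ ab))

  closedIndex-injective : ∀ {a b b′} (p : ClosedNeighbour a b) (p′ : ClosedNeighbour a b′) →
                          closedIndex p ≡ closedIndex p′ → b ≡ b′
  closedIndex-injective (inj₁ refl) (inj₁ refl) _ = refl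
  closedIndex-injective (inj₂ ab) (inj₂ ab′) eq =
    trans (lookup-index (neighbour∈ ab))
          (trans (cong (lookup (neighbours _)) (suc-injective eq)) (sym (lookup-index (neighbour∈ ab′))))

-- Upper bound: Γ(G[H]) ≤ (Δ(G) + 1) Γ(H)

module UpperBound {G H : Graph} {γH m : ℕ} (grundyH : IsGrundyNumber H γH)
                  (C : GreedyLexColouring G H (suc m)) where
  open GreedyLexColouring C

  fibre-greedy : ∀ b x j → j < colour b x → Occurs H (colour b) j →
                 ∃ λ y → Adj H x y × colour b y ≡ j
  fibre-greedy b x j j<bx (z , bz≡j) with greedy b x j j<bx
  -- a neighbour of colour j in another fibre would also be adjacent to (b , z)
  ... | b′ , y , inj₁ bb′ , b′y≡j = contradiction (trans bz≡j (sym b′y≡j)) (stable (inj₁ bb′))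
  ... | _  , y , inj₂ (refl , xy) , by≡j = y , xy , by≡j

  fibreColours≤ : ∀ b → occurring H (colour b) .size ℕ.≤ γH
  fibreColours≤ b =
    proj₂ grundyH _ (compress H (colour b) (λ xy → stable (inj₂ (refl , xy))) (fibre-greedy b))

  rank : ∀ b j → Occurs H (colour b) j → Fin γH
  rank b j p = inject≤ (occurring H (colour b) .index j p) (fibreColours≤ b)

  rank-injective : ∀ {b b′ j j′} → b ≡ b′ →
                   (p : Occurs H (colour b) j) (p′ : Occurs H (colour b′) j′) →
                   rank b j p ≡ rank b′ j′ p′ → j ≡ j′
  rank-injective refl p p′ eq = index-injective (occurring H _) p p′ (inject≤-injective _ _ _ _ eq)

  top : ∃₂ λ a x → colour a x ≡ fromℕ m
  top = nonempty (fromℕ m)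

  a : Fin (n G)
  a = proj₁ top

  x₀ : Fin (n H)
  x₀ = proj₁ (proj₂ top)

  occursNear : ∀ j → ∃ λ b → ClosedNeighbour G a b × Occurs H (colour b) j
  occursNear j with j F.≟ colour a x₀
  ... | yes refl = a , inj₁ refl , x₀ , refl
  ... | no j≢ax₀ with greedy a x₀ j (≤∧≢⇒< (subst (j F.≤_) (sym (proj₂ (proj₂ top))) (≤fromℕ j)) j≢ax₀)
  ...   | b , y , inj₁ ab , by≡j           = b , inj₂ ab , y , by≡j
  ...   | _ , y , inj₂ (refl , _) , ay≡j = a , inj₁ refl , y , ay≡j

  slot : Fin (suc m) → Fin (suc (degree G a) * γH)
  slot j = let (b , ab , p) = occursNear j in combine (closedIndex G ab) (rank b j p)

  slot-injective : ∀ {j j′} → slot j ≡ slot j′ → j ≡ j′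
  slot-injective {j} {j′} eq with occursNear j | occursNear j′
  ... | b , ab , p | b′ , ab′ , p′
    with combine-injective (closedIndex G ab) (rank b j p) (closedIndex G ab′) (rank b′ j′ p′) eq
  ...   | ab≡ab′ , rank≡ = rank-injective (closedIndex-injective G ab ab′ ab≡ab′) p p′ rank≡

  colours≤ : suc m ℕ.≤ suc (maxDegree G) * γH
  colours≤ = ℕ.≤-trans (injective⇒≤ slot-injective)
                       (ℕ.*-monoˡ-≤ γH (s≤s (degree≤maxDegree G a)))

grundyLex≤ : ∀ {G H γH k} → IsGrundyNumber H γH → GreedyColouring (lex G H) k →
             k ℕ.≤ suc (maxDegree G) * γH
grundyLex≤ {k = zero}  _       _ = z≤n
grundyLex≤ {k = suc m} grundyH C = UpperBound.colours≤ grundyH (toPairs C)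

theorem13 : (G H : Graph) (γG γH : ℕ) →
    IsGrundyNumber G γG → IsGrundyNumber H γH →
    γG ≡ maxDegree G + 1 →
    IsGrundyNumber (lex G H) (γG * γH)
theorem13 G H γG γH (CG , _) grundyH@(CH , _) γG≡Δ+1 =
  fromPairs (lexProductColouring CG CH) , upper
  where
  γG≡1+Δ : γG ≡ suc (maxDegree G)
  γG≡1+Δ = trans γG≡Δ+1 (ℕ.+-comm (maxDegree G) 1)

  upper : ∀ k → GreedyColouring (lex G H) k → k ℕ.≤ γG * γH
  upper k C = subst (λ γ → k ℕ.≤ γ * γH) (sym γG≡1+Δ) (grundyLex≤ grundyH C)
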